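{- Let $\alpha\ge 1$, $\beta\ge 1$ be integers, $\ell=\min\{\alpha,\beta\}$, $u=\max\{\alpha,\beta\}$. Let $g(k)=0$ for $k<0$, $g(0)=1$, $g(k)=g(k-\alpha)+g(k-\beta)$ for $k\ge1$, and $G(k)=\sum_{i=1}^{\ell} g(k+1-i)$. For every integer $k\ge 0$, the complete $(\alpha,\beta)$ decision tree of level $k$ has exactly $G(k)$ leaves.
   Context: An $(\alpha,\beta)$ decision tree is a rooted binary tree in which each node has a level: the root has level $0$, and each node $v$ of level $d_v$ is either a leaf or has exactly two children, a left child at level $d_v+\alpha$ and a right child at level $d_v+\beta$. The complete $(\alpha,\beta)$ decision tree of level $k$ is the finite $(\alpha,\beta)$ decision tree obtained from the root by giving both children to every node whose children would both have level at most $k$ (i.e. every node of level at most $k-u$), all other nodes being leaves; it is the $(\alpha,\beta)$ decision tree with all node levels at most $k$ having the maximum number of leaves. -}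

module Defs where

open import Data.Nat using (ℕ; zero; suc; _+_; _≤_; _⊔_; _⊓_)
open import Data.Integer using (ℤ; +_; _-_)
open import Relation.Nullary using (¬_)

data Tree : Set where
  leaf : Tree
  node : (left right : Tree) → Tree

leaves : Tree → ℕ
leaves leaf       = 1
leaves (node l r) = leaves l + leaves r

-- CompleteAt α β k d t : t is the subtree rooted at a node of level d of the
-- complete (α,β) decision tree of level k.  A node of
-- level d gets both children iff d ≤ k - u (i.e. d + u ≤ k), u = max{α,β};
-- otherwise it is a leaf.
data CompleteAt (α β k : ℕ) : ℕ → Tree → Set where
  internal : ∀ {d l r} → d + (α ⊔ β) ≤ k →
             CompleteAt α β k (d + α) l → CompleteAt α β k (d + β) r →
             CompleteAt α β k d (node l r)
  external : ∀ {d} → ¬ (d + (α ⊔ β) ≤ k) → CompleteAt α β k d leaf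

IsCompleteTree : (α β k : ℕ) → Tree → Set
IsCompleteTree α β k t = CompleteAt α β k 0 t

sumG : (ℤ → ℕ) → ℕ → ℕ → ℕ
sumG g k zero    = 0
sumG g k (suc i) = sumG g k i + g (+ (suc k) - + (suc i))

G : (α β : ℕ) → (ℤ → ℕ) → ℕ → ℕ
G α β g k = sumG g k (α ⊓ β)

module Submission where

-- A node of level d of the complete tree of level k has "budget" j = k - d,
-- and it is internal exactly when u ≤ j (u = max{α,β}); its children have
-- budgets j - α and j - β.  Hence the number of leaves below a node depends
-- only on its budget j, and it is the unique F : ℕ → ℕ with F j = 1 for
-- j < u and F j = F (j - α) + F (j - β) for j ≥ u (`leaves-complete`).
--
-- It then suffices to show that G satisfies these two equations.  G j is a
-- window sum Σ_{i=1}^{ℓ} g(j+1-i) of g, and we first develop window sums of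
-- an arbitrary g : ℤ → ℕ: sliding the window by one step, additivity,
-- translation, and the window ending at 0.  The recurrence of g transfers
-- to G by additivity and translation (`G-recurrence`); for j < u, sliding
-- the window leaves G unchanged since g(j+1) = g(j+1-ℓ) + g(j+1-u) and
-- g(j+1-u) = 0 (`G-below-max`).  Finally the complete tree of level k
-- exists (`complete-tree-exists`), which needs α, β ≥ 1 for finiteness.

open import Defs
open import Data.Nat using (ℕ; _≤_) renaming (_+_ to _ℕ+_)
open import Data.Integer using (ℤ; +_; _-_; _<_; 0ℤ; 1ℤ) renaming (_≤_ to _≤ℤ_)
open import Data.Product using (Σ; _×_)
open import Relation.Binary.PropositionalEquality using (_≡_)

open import Data.Nat as ℕ using (zero; suc; _+_; _∸_; _⊔_; _⊓_; z≤n; s≤s; _≤?_)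
import Data.Nat.Properties as ℕP
import Data.Integer as ℤ
import Data.Integer.Properties as ℤP
import Data.Integer.Tactic.RingSolver as ℤ-Solver
open import Algebra.Properties.CommutativeSemigroup ℕP.+-commutativeSemigroup
  using (interchange)
open import Data.Product using (_,_)
open import Data.Sum using (inj₁; inj₂)
open import Data.Empty using (⊥-elim)
open import Relation.Nullary using (yes; no)
open import Relation.Binary.PropositionalEquality
  using (refl; sym; trans; cong; cong₂; subst; module ≡-Reasoning)
open ≡-Reasoning

index-negative : ∀ {m n} → m ℕ.< n → + m - + n < 0ℤ
index-negative {m} {n} m<n rewrite ℤP.m-n≡m⊖n m n | ℤP.⊖-< m<n =
  ℤP.neg-mono-< (ℤ.+<+ (ℕP.m<n⇒0<n∸m m<n))

index-positive : ∀ {i j} → i ℕ.< j → 1ℤ ≤ℤ + suc j - + suc i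
index-positive {i} {j} i<j
  rewrite ℤP.m-n≡m⊖n (suc j) (suc i) | ℤP.⊖-≥ (s≤s (ℕP.<⇒≤ i<j)) =
  ℤ.+≤+ (ℕP.m<n⇒0<n∸m i<j)

index-slide : ∀ k m → + suc (suc k) - + suc m ≡ + suc k - + m
index-slide k m = cancel-one (+ suc k) (+ m)
  where
  cancel-one : ∀ (x y : ℤ) → (1ℤ ℤ.+ x) - (1ℤ ℤ.+ y) ≡ x - y
  cancel-one = ℤ-Solver.solve-∀

index-translate : ∀ {c j} i → c ≤ j → + suc (j ∸ c) - + suc i ≡ (+ suc j - + suc i) - + c
index-translate {c} {j} i c≤j = begin
  (1ℤ ℤ.+ + (j ∸ c)) - + suc i  ≡⟨ cong (λ z → (1ℤ ℤ.+ z) - + suc i) j∸c≡j-c ⟩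
  (1ℤ ℤ.+ (+ j - + c)) - + suc i ≡⟨ reorder (+ j) (+ c) (+ suc i) ⟩
  (+ suc j - + suc i) - + c      ∎
  where
  j∸c≡j-c : + (j ∸ c) ≡ + j - + c
  j∸c≡j-c = sym (trans (ℤP.m-n≡m⊖n j c) (ℤP.⊖-≥ c≤j))
  reorder : ∀ (x y z : ℤ) → (1ℤ ℤ.+ (x - y)) - z ≡ ((1ℤ ℤ.+ x) - z) - y
  reorder = ℤ-Solver.solve-∀

split-min-max : ∀ (f : ℕ → ℕ) α β → f α + f β ≡ f (α ⊓ β) + f (α ⊔ β)
split-min-max f α β with ℕP.≤-total α β
... | inj₁ α≤β rewrite ℕP.m≤n⇒m⊓n≡m α≤β | ℕP.m≤n⇒m⊔n≡n α≤β = refl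
... | inj₂ β≤α rewrite ℕP.m≥n⇒m⊓n≡n β≤α | ℕP.m≥n⇒m⊔n≡m β≤α = ℕP.+-comm (f α) (f β)

sumG-slide : ∀ (g : ℤ → ℕ) k m →
  sumG g (suc k) m + g (+ suc k - + m) ≡ g (+ suc k) + sumG g k m
sumG-slide g k zero = begin
  g (+ suc k - 0ℤ) ≡⟨ cong g (ℤP.+-identityʳ (+ suc k)) ⟩
  g (+ suc k)      ≡⟨ ℕP.+-identityʳ (g (+ suc k)) ⟨
  g (+ suc k) + 0  ∎
sumG-slide g k (suc m) = begin
  (sumG g (suc k) m + g (+ suc (suc k) - + suc m)) + g (+ suc k - + suc m)
    ≡⟨ cong (λ z → (sumG g (suc k) m + g z) + g (+ suc k - + suc m)) (index-slide k m) ⟩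
  (sumG g (suc k) m + g (+ suc k - + m)) + g (+ suc k - + suc m)
    ≡⟨ cong (_+ g (+ suc k - + suc m)) (sumG-slide g k m) ⟩
  (g (+ suc k) + sumG g k m) + g (+ suc k - + suc m)
    ≡⟨ ℕP.+-assoc (g (+ suc k)) (sumG g k m) (g (+ suc k - + suc m)) ⟩
  g (+ suc k) + (sumG g k m + g (+ suc k - + suc m))  ∎

sumG-additive : ∀ (g h₁ h₂ : ℤ → ℕ) k m →
  (∀ i → i ℕ.< m → g (+ suc k - + suc i) ≡ h₁ (+ suc k - + suc i) + h₂ (+ suc k - + suc i)) →
  sumG g k m ≡ sumG h₁ k m + sumG h₂ k m
sumG-additive g h₁ h₂ k zero split = refl
sumG-additive g h₁ h₂ k (suc m) split = begin
  sumG g k m + g x                                   ≡⟨ cong₂ _+_ window-sums (split m ℕP.≤-refl) ⟩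
  (sumG h₁ k m + sumG h₂ k m) + (h₁ x + h₂ x)        ≡⟨ interchange (sumG h₁ k m) (sumG h₂ k m) (h₁ x) (h₂ x) ⟩
  (sumG h₁ k m + h₁ x) + (sumG h₂ k m + h₂ x)        ∎
  where
  x : ℤ
  x = + suc k - + suc m
  window-sums : sumG g k m ≡ sumG h₁ k m + sumG h₂ k m
  window-sums = sumG-additive g h₁ h₂ k m (λ i i<m → split i (ℕP.m<n⇒m<1+n i<m))

sumG-translate : ∀ (g : ℤ → ℕ) {c j} m → c ≤ j →
  sumG (λ z → g (z - + c)) j m ≡ sumG g (j ∸ c) m
sumG-translate g zero c≤j = refl
sumG-translate g (suc m) c≤j =
  cong₂ _+_ (sumG-translate g m c≤j) (cong g (sym (index-translate m c≤j)))

sumG-at-zero : ∀ (g : ℤ → ℕ) → (∀ k → k < 0ℤ → g k ≡ 0) → g 0ℤ ≡ 1 →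
  ∀ m → 1 ≤ m → sumG g 0 m ≡ 1
sumG-at-zero g negative g0 (suc zero) _ = g0
sumG-at-zero g negative g0 (suc (suc m)) _ = begin
  sumG g 0 (suc m) + g (1ℤ - + suc (suc m))  ≡⟨ cong (_+_ (sumG g 0 (suc m))) (negative _ (index-negative (s≤s (s≤s z≤n)))) ⟩
  sumG g 0 (suc m) + 0                       ≡⟨ ℕP.+-identityʳ _ ⟩
  sumG g 0 (suc m)                           ≡⟨ sumG-at-zero g negative g0 (suc m) (s≤s z≤n) ⟩
  1                                          ∎

module LeafCount (α β : ℕ) (g : ℤ → ℕ)
  (negative : ∀ k → k < 0ℤ → g k ≡ 0) (g0 : g 0ℤ ≡ 1)
  (recurrence : ∀ k → 1ℤ ≤ℤ k → g k ≡ g (k - + α) + g (k - + β)) where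

  private
    ℓ u : ℕ
    ℓ = α ⊓ β
    u = α ⊔ β

  -- Once the whole window lies in the positive range, the recurrence of g
  -- transfers to its window sums, hence to G.
  G-recurrence : ∀ j → u ≤ j → G α β g j ≡ G α β g (j ∸ α) + G α β g (j ∸ β)
  G-recurrence j u≤j = begin
    sumG g j ℓ
      ≡⟨ sumG-additive g (λ z → g (z - + α)) (λ z → g (z - + β)) j ℓ
           (λ i i<ℓ → recurrence _ (index-positive (ℕP.<-≤-trans i<ℓ ℓ≤j))) ⟩
    sumG (λ z → g (z - + α)) j ℓ + sumG (λ z → g (z - + β)) j ℓ
      ≡⟨ cong₂ _+_ (sumG-translate g ℓ α≤j) (sumG-translate g ℓ β≤j) ⟩
    sumG g (j ∸ α) ℓ + sumG g (j ∸ β) ℓ  ∎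
    where
    ℓ≤j : ℓ ≤ j
    ℓ≤j = ℕP.≤-trans (ℕP.m⊓n≤m⊔n α β) u≤j
    α≤j : α ≤ j
    α≤j = ℕP.≤-trans (ℕP.m≤m⊔n α β) u≤j
    β≤j : β ≤ j
    β≤j = ℕP.≤-trans (ℕP.m≤n⊔m α β) u≤j

  -- Below u, G is constantly 1: G(0) = g(0), and sliding the window from j
  -- to j+1 < u adds g(j+1) and drops g(j+1-ℓ), which are equal because
  -- the remaining term g(j+1-u) of the recurrence has a negative index.
  G-below-max : 1 ≤ α → 1 ≤ β → ∀ j → j ℕ.< u → G α β g j ≡ 1
  G-below-max 1≤α 1≤β zero _ = sumG-at-zero g negative g0 ℓ (ℕP.⊓-glb 1≤α 1≤β)
  G-below-max 1≤α 1≤β (suc j) j+1<u =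
    trans (ℕP.+-cancelʳ-≡ dropped (G α β g (suc j)) (G α β g j) slide-even)
          (G-below-max 1≤α 1≤β j (ℕP.<⇒≤ j+1<u))
    where
    dropped : ℕ
    dropped = g (+ suc j - + ℓ)
    added≡dropped : g (+ suc j) ≡ dropped
    added≡dropped = begin
      g (+ suc j)                             ≡⟨ recurrence _ (ℤ.+≤+ (s≤s z≤n)) ⟩
      g (+ suc j - + α) + g (+ suc j - + β)   ≡⟨ split-min-max (λ c → g (+ suc j - + c)) α β ⟩
      dropped + g (+ suc j - + u)             ≡⟨ cong (_+_ dropped) (negative _ (index-negative j+1<u)) ⟩
      dropped + 0                             ≡⟨ ℕP.+-identityʳ dropped ⟩
      dropped                                 ∎
    slide-even : G α β g (suc j) + dropped ≡ G α β g j + dropped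
    slide-even = begin
      G α β g (suc j) + dropped   ≡⟨ sumG-slide g j ℓ ⟩
      g (+ suc j) + G α β g j     ≡⟨ cong (_+ G α β g j) added≡dropped ⟩
      dropped + G α β g j         ≡⟨ ℕP.+-comm dropped (G α β g j) ⟩
      G α β g j + dropped         ∎

-- Complete trees of level k, described through budgets: a node of level d
-- has budget j = k - d, i.e. d + j ≡ k.
module CompleteTrees (α β k : ℕ) where

  private
    u : ℕ
    u = α ⊔ β

  internal⇒budget : ∀ {d j} → d + j ≡ k → d + u ≤ k → u ≤ j
  internal⇒budget {d} {j} d+j≡k d+u≤k =
    ℕP.+-cancelˡ-≤ d u j (subst (d + u ≤_) (sym d+j≡k) d+u≤k)

  budget⇒internal : ∀ {d j} → d + j ≡ k → u ≤ j → d + u ≤ k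
  budget⇒internal {d} d+j≡k u≤j = subst (d + u ≤_) d+j≡k (ℕP.+-monoʳ-≤ d u≤j)

  child-budget : ∀ {d j} c → d + j ≡ k → c ≤ j → (d + c) + (j ∸ c) ≡ k
  child-budget {d} {j} c d+j≡k c≤j = begin
    (d + c) + (j ∸ c)  ≡⟨ ℕP.+-assoc d c (j ∸ c) ⟩
    d + (c + (j ∸ c))  ≡⟨ cong (_+_ d) (ℕP.m+[n∸m]≡n c≤j) ⟩
    d + j              ≡⟨ d+j≡k ⟩
    k                  ∎

  leaves-complete : (F : ℕ → ℕ) →
    (∀ j → j ℕ.< u → F j ≡ 1) →
    (∀ j → u ≤ j → F j ≡ F (j ∸ α) + F (j ∸ β)) →
    ∀ {d t} → CompleteAt α β k d t → ∀ j → d + j ≡ k → leaves t ≡ F j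
  leaves-complete F F-small F-large (internal d+u≤k left right) j d+j≡k =
    trans (cong₂ _+_ (leaves-complete F F-small F-large left (j ∸ α) (child-budget α d+j≡k α≤j))
                     (leaves-complete F F-small F-large right (j ∸ β) (child-budget β d+j≡k β≤j)))
          (sym (F-large j u≤j))
    where
    u≤j : u ≤ j
    u≤j = internal⇒budget d+j≡k d+u≤k
    α≤j : α ≤ j
    α≤j = ℕP.≤-trans (ℕP.m≤m⊔n α β) u≤j
    β≤j : β ≤ j
    β≤j = ℕP.≤-trans (ℕP.m≤n⊔m α β) u≤j
  leaves-complete F F-small F-large (external d+u≰k) j d+j≡k with u ≤? j
  ... | yes u≤j = ⊥-elim (d+u≰k (budget⇒internal d+j≡k u≤j))
  ... | no u≰j  = sym (F-small j (ℕP.≰⇒> u≰j))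

  -- Every node has a complete subtree, built by recursion on a bound n
  -- for its budget; since α, β ≥ 1 the children have strictly smaller
  -- budgets.
  subtree-exists : 1 ≤ α → 1 ≤ β → ∀ n {d j} → d + j ≡ k → j ℕ.< n →
    Σ Tree (CompleteAt α β k d)
  subtree-exists 1≤α 1≤β (suc n) {d} {j} d+j≡k j<1+n with u ≤? j
  ... | no u≰j  = leaf , external (λ d+u≤k → u≰j (internal⇒budget d+j≡k d+u≤k))
  ... | yes u≤j =
    let (l , left)  = subtree-exists 1≤α 1≤β n (child-budget α d+j≡k α≤j) (shrinks 1≤α α≤j)
        (r , right) = subtree-exists 1≤α 1≤β n (child-budget β d+j≡k β≤j) (shrinks 1≤β β≤j)
    in node l r , internal (budget⇒internal d+j≡k u≤j) left right
    where
    α≤j : α ≤ j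
    α≤j = ℕP.≤-trans (ℕP.m≤m⊔n α β) u≤j
    β≤j : β ≤ j
    β≤j = ℕP.≤-trans (ℕP.m≤n⊔m α β) u≤j
    shrinks : ∀ {c} → 1 ≤ c → c ≤ j → j ∸ c ℕ.< n
    shrinks 1≤c c≤j = ℕP.<-≤-trans (ℕP.∸-monoʳ-< 1≤c c≤j) (ℕ.s≤s⁻¹ j<1+n)

  complete-tree-exists : 1 ≤ α → 1 ≤ β → Σ Tree (IsCompleteTree α β k)
  complete-tree-exists 1≤α 1≤β = subtree-exists 1≤α 1≤β (suc k) {0} refl (ℕP.n<1+n k)

proposition4 : (α β : ℕ) → 1 ≤ α → 1 ≤ β →
    (g : ℤ → ℕ) →
    (∀ k → k < 0ℤ → g k ≡ 0) →
    g 0ℤ ≡ 1 →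
    (∀ k → 1ℤ ≤ℤ k → g k ≡ g (k - + α) ℕ+ g (k - + β)) →
    (k : ℕ) →
    Σ Tree (λ t → IsCompleteTree α β k t)
    × (∀ t → IsCompleteTree α β k t → leaves t ≡ G α β g k)
proposition4 α β 1≤α 1≤β g negative g0 recurrence k =
    complete-tree-exists 1≤α 1≤β
  , λ t complete → leaves-complete (G α β g) (G-below-max 1≤α 1≤β) G-recurrence complete k refl
  where
  open CompleteTrees α β k
  open LeafCount α β g negative g0 recurrence
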